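{- Consider the PDSTSP setting described in the context. For every subset $S \subseteq V_c$ with $S\cap V_t\neq\varnothing$ and $|S| \geq 3$, every feasible PDSTSP solution $(x,y)$ satisfies $$\sum_{(i,j)\in E:\ |\{i,j\}\cap S|=1} x_{ij} \geq 2 ,$$ where the sum ranges over all edges of $G$ with exactly one endpoint in $S$.
   Context: Parallel Drone Scheduling Traveling Salesman Problem (PDSTSP). There is a complete undirected graph $G=(V,E)$ with $V=\{0,1,\dots,n,n+1\}$ and $E=\{(i,j): i,j\in V,\ i<j\}$. Vertex $0$ is the depot and vertex $n+1$ is a copy of the depot. The customers are $V_c=\{1,\dots,n\}$. A subset $V_d\subseteq V_c$ consists of drone-eligible customers, and $V_t=V_c\setminus V_d$ are the customers that must be served by the truck. The variables are binary $x_{ij}$ for edges $(i,j)\in E$ (equal to 1 if the truck travels edge $(i,j)$) and binary $y_i$ for $i \in V$ (equal to 1 if vertex $i$ is visited by the truck), with $y_0=y_{n+1}=1$. Each customer with $y_i=0$ is served by one of the drones via back-and-forth trips from the depot; the drone variables are irrelevant here. A pair $(x,y)$ is a feasible PDSTSP solution if: $y_i=1$ for all $i\in V_t$; and $x$ is the incidence vector of the edge set of a simple path in $G$ from $0$ to $n+1$ whose interior vertices are exactly the customers $i\in V_c$ with $y_i=1$. In particular, every customer $j$ satisfies $\sum_{i<j}x_{ij}+\sum_{k>j}x_{jk}=2y_j$. -}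

module Defs where

open import Data.Nat using (ℕ; zero; suc; _+_; _≤_; _<_; _<ᵇ_)
open import Data.Fin using (Fin; toℕ; fromℕ) renaming (zero to fzero)
open import Data.Bool using (Bool; true; false; _xor_; _∧_; if_then_else_)
open import Data.Vec using (lookup)
open import Data.List using (List; []; _∷_; _++_; [_]; map; allFin)
open import Data.Nat.ListAction using (sum)
open import Data.List.Membership.Propositional using (_∈_)
open import Data.List.Relation.Unary.Unique.Propositional using (Unique)
open import Data.Fin.Subset using (Subset; _⊆_)
open import Data.Product using (_×_; ∃)
open import Data.Sum using (_⊎_)
open import Relation.Binary.PropositionalEquality using (_≡_)
open import Function.Bundles using (_⇔_)

Vertex : ℕ → Set
Vertex n = Fin (2 + n)

-- the depot 0 and its copy n+1
depot : (n : ℕ) → Vertex n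
depot n = fzero

depot′ : (n : ℕ) → Vertex n
depot′ n = fromℕ (suc n)

IsCustomer : (n : ℕ) → Vertex n → Set
IsCustomer n i = (1 ≤ toℕ i) × (toℕ i ≤ n)

IsTruckCustomer : (n : ℕ) → Subset (2 + n) → Vertex n → Set
IsTruckCustomer n Vd i = IsCustomer n i × (lookup Vd i ≡ false)

data ConsecPair {A : Set} : List A → A → A → Set where
  here  : ∀ {a b xs} → ConsecPair (a ∷ b ∷ xs) a b
  there : ∀ {c a b xs} → ConsecPair xs a b → ConsecPair (c ∷ xs) a b

truckPath : (n : ℕ) → List (Vertex n) → List (Vertex n)
truckPath n inner = depot n ∷ (inner ++ [ depot′ n ])

IsPathSolution : (n : ℕ) → (Vertex n → Vertex n → Bool) → (Vertex n → Bool)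
               → List (Vertex n) → Set
IsPathSolution n x y inner =
    Unique (truckPath n inner)
  × (∀ v → (v ∈ inner) ⇔ (IsCustomer n v × (y v ≡ true)))
  × (∀ i j → toℕ i < toℕ j →
       (x i j ≡ true) ⇔ (ConsecPair (truckPath n inner) i j
                          ⊎ ConsecPair (truckPath n inner) j i))

Feasible : (n : ℕ) → Subset (2 + n) → (Vertex n → Vertex n → Bool)
         → (Vertex n → Bool) → Set
Feasible n Vd x y =
    (y (depot n) ≡ true) × (y (depot′ n) ≡ true)
  × (∀ i → IsTruckCustomer n Vd i → y i ≡ true)
  × (∃ λ inner → IsPathSolution n x y inner)

boolToℕ : Bool → ℕ
boolToℕ true = 1
boolToℕ false = 0

cutValue : (n : ℕ) → (Vertex n → Vertex n → Bool) → Subset (2 + n) → ℕ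
cutValue n x S =
  sum (map (λ i → sum (map (λ j →
         if (toℕ i <ᵇ toℕ j) ∧ (lookup S i xor lookup S j)
         then boolToℕ (x i j) else 0) (allFin (2 + n)))) (allFin (2 + n)))

-- The truck path starts and ends at the depot, which lies outside S, and
-- passes through a truck customer t ∈ S.  Before t it must step into S
-- along some path edge {a, b} and after t it must step out of S along some
-- path edge {c, d}.  Both edges cross the cut, and they are different: the
-- same edge would be traversed as a → b and as b → a, which a simple path
-- does not do.
module Submission where

open import Defs
open import Data.Nat using (ℕ; suc; _≤_; _<_; _+_; _<ᵇ_)
open import Data.Nat.Properties
  using (≤-trans; m≤m+n; m≤n+m; +-mono-≤; +-monoʳ-≤; +-comm; <-cmp; <⇒<ᵇ; <-irrefl)
open import Data.Bool using (Bool; true; false; not; _xor_; _∧_; if_then_else_)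
open import Data.Bool.Properties using (xor-comm; xor-same; not-injective; T-≡)
open import Data.Vec using (lookup)
open import Data.Fin using (toℕ; _≟_)
open import Data.Fin.Properties using (toℕ-injective; toℕ-fromℕ)
open import Data.Fin.Subset using (Subset; ∣_∣)
open import Data.List using (List; _∷_; _++_; [_]; map; allFin)
open import Data.Nat.ListAction using (sum)
open import Data.List.Membership.Propositional using (_∈_)
open import Data.List.Membership.Propositional.Properties using (∈-allFin; ∈-++⁺ˡ; ∈-++⁺ʳ)
open import Data.List.Relation.Unary.Any using (here; there)
open import Data.List.Relation.Unary.All as All using ()
open import Data.List.Relation.Unary.AllPairs using (_∷_)
open import Data.List.Relation.Unary.Unique.Propositional using (Unique)
open import Data.Product using (∃; ∃₂; _×_; _,_; proj₁; proj₂)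
open import Data.Sum using (inj₁; inj₂)
open import Data.Empty using (⊥-elim)
open import Relation.Nullary using (¬_; yes; no)
open import Relation.Binary using (tri<; tri≈; tri>; DecidableEquality)
open import Relation.Binary.PropositionalEquality
  using (_≡_; _≢_; refl; sym; trans; cong; cong₂; subst; subst₂)
open import Function.Base using (_∘_)
open import Function.Bundles using (Equivalence)

private
  variable
    A : Set
    a b c d h u z : A
    xs ys : List A

sum-map-≥ : (g : A → ℕ) → u ∈ xs → g u ≤ sum (map g xs)
sum-map-≥ {xs = x ∷ _} g (here refl) = m≤m+n (g x) _
sum-map-≥ {xs = x ∷ _} g (there u∈xs) = ≤-trans (sum-map-≥ g u∈xs) (m≤n+m _ (g x))

sum-map-≥₂ : ∀ {A : Set} {a b : A} {xs} (g : A → ℕ) →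
             a ∈ xs → b ∈ xs → a ≢ b → g a + g b ≤ sum (map g xs)
sum-map-≥₂ g (here refl) (here refl) a≢b = ⊥-elim (a≢b refl)
sum-map-≥₂ {a = a} g (here refl) (there b∈xs) _ = +-monoʳ-≤ (g a) (sum-map-≥ g b∈xs)
sum-map-≥₂ {a = a} {b} {_ ∷ xs} g (there a∈xs) (here refl) _ =
  subst (_≤ g b + sum (map g xs)) (+-comm (g b) (g a)) (+-monoʳ-≤ (g b) (sum-map-≥ g a∈xs))
sum-map-≥₂ {xs = x ∷ _} g (there a∈xs) (there b∈xs) a≢b =
  ≤-trans (sum-map-≥₂ g a∈xs b∈xs a≢b) (m≤n+m _ (g x))

doubleSum-≥₂ : ∀ {A : Set} {a b c d : A} {xs ys} → DecidableEquality A → (f : A → A → ℕ) →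
               a ∈ xs → b ∈ ys → c ∈ xs → d ∈ ys → ¬ (a ≡ c × b ≡ d) →
               f a b + f c d ≤ sum (map (λ i → sum (map (f i) ys)) xs)
doubleSum-≥₂ {a = a} {c = c} {ys = ys} _≟_ f a∈xs b∈ys c∈xs d∈ys distinct with a ≟ c
... | yes refl = ≤-trans (sum-map-≥₂ (f a) b∈ys d∈ys λ b≡d → distinct (refl , b≡d))
                         (sum-map-≥ (λ i → sum (map (f i) ys)) a∈xs)
... | no a≢c = ≤-trans (+-mono-≤ (sum-map-≥ (f a) b∈ys) (sum-map-≥ (f c) d∈ys))
                       (sum-map-≥₂ (λ i → sum (map (f i) ys)) a∈xs c∈xs a≢c)

consecPair-∈ : ConsecPair xs a b → a ∈ xs × b ∈ xs
consecPair-∈ here = here refl , there (here refl)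
consecPair-∈ (there p) with a∈ , b∈ ← consecPair-∈ p = there a∈ , there b∈

Unique⇒¬consecPair-flip : Unique xs → ConsecPair xs a b → ¬ ConsecPair xs b a
Unique⇒¬consecPair-flip (a∉ ∷ _) here here = All.lookup a∉ (here refl) refl
Unique⇒¬consecPair-flip (a∉ ∷ _) here (there q) = All.lookup a∉ (proj₂ (consecPair-∈ q)) refl
Unique⇒¬consecPair-flip (b∉ ∷ _) (there p) here = All.lookup b∉ (proj₂ (consecPair-∈ p)) refl
Unique⇒¬consecPair-flip (_ ∷ u) (there p) (there q) = Unique⇒¬consecPair-flip u p q

consecPair-enters : (P : A → Bool) → P h ≡ false → u ∈ h ∷ xs → P u ≡ true →
                    ∃₂ λ a b → ConsecPair (h ∷ xs) a b × P a ≡ false × P b ≡ true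
consecPair-enters P Ph (here refl) Pu with () ← trans (sym Ph) Pu
consecPair-enters {xs = y ∷ _} P Ph (there u∈) Pu with P y in Py
... | true = _ , y , here , Ph , Py
... | false with a , b , p , Pa , Pb ← consecPair-enters P Py u∈ Pu =
  a , b , there p , Pa , Pb

-- Leaving the set after u is entering its complement, in the suffix starting at u.
consecPair-leaves : (P : A → Bool) → P u ≡ true → u ∈ xs → P z ≡ false →
                    ∃₂ λ a b → ConsecPair (xs ++ [ z ]) a b × P a ≡ true × P b ≡ false
consecPair-leaves P Pu (here {xs = ys} refl) Pz
  with a , b , p , ¬Pa , ¬Pb ← consecPair-enters (not ∘ P) (cong not Pu)
                                 (there (∈-++⁺ʳ ys (here refl))) (cong not Pz) =
  a , b , p , not-injective ¬Pa , not-injective ¬Pb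
consecPair-leaves P Pu (there u∈) Pz with a , b , p , Pa , Pb ← consecPair-leaves P Pu u∈ Pz =
  a , b , there p , Pa , Pb

data SameEdge {A : Set} (a b : A) : A → A → Set where
  forward  : SameEdge a b a b
  backward : SameEdge a b b a

sameEdge-crossings : (P : A → Bool) → {i j : A} → SameEdge a b i j → SameEdge c d i j →
                     P a ≡ false → P b ≡ true → P c ≡ true → P d ≡ false → a ≡ d × b ≡ c
sameEdge-crossings P forward  forward  Pa _  Pc _  with () ← trans (sym Pa) Pc
sameEdge-crossings P forward  backward _  _  _  _  = refl , refl
sameEdge-crossings P backward forward  _  _  _  _  = refl , refl
sameEdge-crossings P backward backward _  Pb _  Pd with () ← trans (sym Pd) Pb

module _ {n : ℕ} (x : Vertex n → Vertex n → Bool) (S : Subset (2 + n)) where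

  -- The summand of cutValue, so that cutValue n x S is literally the double sum of cutTerm.
  cutTerm : Vertex n → Vertex n → ℕ
  cutTerm i j = if (toℕ i <ᵇ toℕ j) ∧ (lookup S i xor lookup S j) then boolToℕ (x i j) else 0

  cutTerm-≡1 : {i j : Vertex n} → toℕ i < toℕ j → lookup S i xor lookup S j ≡ true →
               x i j ≡ true → cutTerm i j ≡ 1
  cutTerm-≡1 i<j crossing xij rewrite Equivalence.to T-≡ (<⇒<ᵇ i<j) | crossing | xij = refl

  pathEdge-cutTerm-≡1 : {y : Vertex n → Bool} {inner : List (Vertex n)} {a b : Vertex n} →
                        IsPathSolution n x y inner → ConsecPair (truckPath n inner) a b →
                        lookup S a xor lookup S b ≡ true →
                        ∃₂ λ i j → SameEdge a b i j × cutTerm i j ≡ 1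
  pathEdge-cutTerm-≡1 {a = a} {b} (_ , _ , edges) ab crossing with <-cmp (toℕ a) (toℕ b)
  ... | tri< a<b _ _ = a , b , forward ,
        cutTerm-≡1 a<b crossing (Equivalence.from (edges a b a<b) (inj₁ ab))
  ... | tri≈ _ a≡b _ with refl ← toℕ-injective a≡b
                     with () ← trans (sym (xor-same (lookup S a))) crossing
  ... | tri> _ _ b<a = b , a , backward ,
        cutTerm-≡1 b<a (trans (xor-comm (lookup S b) (lookup S a)) crossing)
                       (Equivalence.from (edges b a b<a) (inj₂ ab))

depot∉customers : (n : ℕ) → ¬ IsCustomer n (depot n)
depot∉customers n (() , _)

depot′∉customers : (n : ℕ) → ¬ IsCustomer n (depot′ n)
depot′∉customers n (_ , n+1≤n) = <-irrefl refl (subst (_≤ n) (toℕ-fromℕ (suc n)) n+1≤n)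

depots∉customerSubset : ∀ {n} (S : Subset (2 + n)) → (∀ i → lookup S i ≡ true → IsCustomer n i) →
          lookup S (depot n) ≡ false × lookup S (depot′ n) ≡ false
depots∉customerSubset {n} S S⊆Vc = ∉ (depot∉customers n) , ∉ (depot′∉customers n)
  where
  ∉ : ∀ {v} → ¬ IsCustomer n v → lookup S v ≡ false
  ∉ {v} v∉Vc with lookup S v in Sv
  ... | false = refl
  ... | true = ⊥-elim (v∉Vc (S⊆Vc v Sv))

proposition4 : (n : ℕ) (Vd : Subset (2 + n)) (S : Subset (2 + n))
    → (∀ i → lookup S i ≡ true → IsCustomer n i)
    → (∃ λ i → (lookup S i ≡ true) × IsTruckCustomer n Vd i)
    → 3 ≤ ∣ S ∣
    → (x : Vertex n → Vertex n → Bool) (y : Vertex n → Bool)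
    → Feasible n Vd x y
    → 2 ≤ cutValue n x S
proposition4 n Vd S S⊆Vc (t , t∈S , t∈Vt) _ x y (_ , _ , truckServed , inner , path@(simple , interior , _))
  with depot∉S , depot′∉S ← depots∉customerSubset S S⊆Vc
  with t∈inner ← Equivalence.from (interior t) (proj₁ t∈Vt , truckServed t t∈Vt)
  with a , b , ab , a∉S , b∈S ← consecPair-enters (lookup S) depot∉S (there (∈-++⁺ˡ t∈inner)) t∈S
     | c , d , cd , c∈S , d∉S ← consecPair-leaves (lookup S) t∈S (there t∈inner) depot′∉S
  with i₁ , j₁ , ij₁ , e₁ ← pathEdge-cutTerm-≡1 x S path ab (cong₂ _xor_ a∉S b∈S)
     | i₂ , j₂ , ij₂ , e₂ ← pathEdge-cutTerm-≡1 x S path cd (cong₂ _xor_ c∈S d∉S) =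
  subst₂ (λ u v → u + v ≤ cutValue n x S) e₁ e₂
    (doubleSum-≥₂ _≟_ (cutTerm x S) (∈-allFin i₁) (∈-allFin j₁) (∈-allFin i₂) (∈-allFin j₂) distinct)
  where
  distinct : ¬ (i₁ ≡ i₂ × j₁ ≡ j₂)
  distinct (refl , refl) with refl , refl ← sameEdge-crossings (lookup S) ij₁ ij₂ a∉S b∈S c∈S d∉S =
    Unique⇒¬consecPair-flip simple ab cd
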